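{- Let $\mathcal K$ be a transitive projective Fraïssé class with projective Fraïssé limit $\mathbb K$. Fix $k\in\mathbb N$, $k\geq 1$. For each $A\in\mathcal K$ and each $\phi\in{\rm Epi}(\mathbb K,A)$ there exist $B\in\mathcal K$, $\psi\in{\rm Epi}(\mathbb K,B)$ and $f\in{\rm Epi}(B,A)$ such that (i) $\phi=f\circ\psi$, and (ii) for all $a,b\in B$, if $a\,R^k\,b$ then $f(a)\,R\,f(b)$.
   Context: A reflexive graph is a set with a reflexive symmetric binary relation $R$. For reflexive graphs $X,Y$, a strong homomorphism $f:X\to Y$ is a map with $x_1Rx_2\Rightarrow f(x_1)Rf(x_2)$ and such that for all $y_1Ry_2$ there are $x_1Rx_2$ with $f(x_1)=y_1,f(x_2)=y_2$. For $k\ge1$, $aR^kb$ means there exist $c_0=a,c_1,\dots,c_k=b$ with $c_iRc_{i+1}$ for all $i<k$. $\mathcal K$ is a countable (up to isomorphism) category whose objects are finite reflexive graphs and whose morphisms (the set of morphisms $A\to B$ is written ${\rm Epi}(A,B)$) are strong homomorphisms, satisfying: (o) if $f\in{\rm Epi}(A,B)$, $h\in{\rm Epi}(A,C)$ and $g:B\to C$ is a function with $h=g\circ f$, then $g\in{\rm Epi}(B,C)$; (joint projection) for any $A,B\in\mathcal K$ there are $C\in\mathcal K$ and morphisms $C\to A$, $C\to B$; (projective amalgamation) for morphisms $f,g$ with common codomain there are morphisms $f',g'$ with $f\circ f'=g\circ g'$. The projective Fraïssé limit: fix $A_n\in\mathcal K$ and $\pi_n\in{\rm Epi}(A_{n+1},A_n)$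 ($n\in\mathbb N$) such that every $A\in\mathcal K$ admits a morphism $A_m\to A$ for some $m$, and for every $f\in{\rm Epi}(A,A_m)$ there are $n>m$ and $g\in{\rm Epi}(A_n,A)$ with $f\circ g=\pi_m\circ\cdots\circ\pi_{n-1}$. Then $\mathbb K=\varprojlim(A_n,\pi_n)$ (a compact totally disconnected metrizable space) with projections $\pi^\infty_n:\mathbb K\to A_n$, and for $A\in\mathcal K$, ${\rm Epi}(\mathbb K,A)=\{f\circ\pi^\infty_n: n\in\mathbb N, f\in{\rm Epi}(A_n,A)\}$; this is unique up to isomorphism. The relation $R^{\mathbb K}$ on $\mathbb K$ is defined by $xR^{\mathbb K}y$ iff $\varphi(x)R\varphi(y)$ for all $A\in\mathcal K$ and $\varphi\in{\rm Epi}(\mathbb K,A)$. $\mathcal K$ is called transitive if $R^{\mathbb K}$ is transitive. -}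

module Defs where

open import Data.Nat using (ℕ; zero; suc; _+_)
open import Data.Fin using (Fin)
open import Data.Bool using (Bool; T)
open import Data.Product using (Σ; ∃; ∃-syntax; _×_; _,_)
open import Relation.Binary.PropositionalEquality using (_≡_)

record FGraph : Set where
  field
    size : ℕ
    rel  : Fin size → Fin size → Bool
    refl : ∀ x → T (rel x x)
    sym  : ∀ x y → T (rel x y) → T (rel y x)

open FGraph public

V : FGraph → Set
V G = Fin (size G)

Adj : (G : FGraph) → V G → V G → Set
Adj G x y = T (rel G x y)

IsStrongHom : (G H : FGraph) → (V G → V H) → Set
IsStrongHom G H f =
  (∀ x₁ x₂ → Adj G x₁ x₂ → Adj H (f x₁) (f x₂)) ×
  (∀ y₁ y₂ → Adj H y₁ y₂ →
     ∃[ x₁ ] ∃[ x₂ ] (Adj G x₁ x₂ × f x₁ ≡ y₁ × f x₂ ≡ y₂))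

AdjPow : (G : FGraph) → ℕ → V G → V G → Set
AdjPow G zero    a b = a ≡ b
AdjPow G (suc k) a b = ∃[ c ] (Adj G a c × AdjPow G k c b)

-- A category 𝒦 of finite reflexive graphs with strong homomorphisms as
-- morphisms (Epi A B is the predicate "f ∈ Epi(A,B)"), satisfying (o),
-- joint projection and projective amalgamation.  Equality of maps is
-- pointwise.

record ProjClass : Set₁ where
  field
    Obj   : Set
    graph : Obj → FGraph

    Epi        : (A B : Obj) → (V (graph A) → V (graph B)) → Set
    epi-strong : ∀ {A B f} → Epi A B f → IsStrongHom (graph A) (graph B) f
    epi-id     : ∀ A → Epi A A (λ x → x)
    epi-comp   : ∀ {A B C f g} → Epi A B f → Epi B C g → Epi A C (λ x → g (f x))
    epi-o      : ∀ {A B C} {f : V (graph A) → V (graph B)} {h : V (graph A) → V (graph C)}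
                   {g : V (graph B) → V (graph C)} →
                 Epi A B f → Epi A C h → (∀ x → h x ≡ g (f x)) → Epi B C g
    joint-proj : ∀ A B → ∃[ C ] ∃[ f ] ∃[ g ] (Epi C A f × Epi C B g)
    proj-amalg : ∀ {A B C} {f : V (graph A) → V (graph C)} {g : V (graph B) → V (graph C)} →
                 Epi A C f → Epi B C g →
                 ∃[ D ] ∃[ f' ] ∃[ g' ]
                   (Epi D A f' × Epi D B g' × (∀ x → f (f' x) ≡ g (g' x)))

  Car : Obj → Set
  Car A = V (graph A)

module _ (𝒦 : ProjClass) where
  open ProjClass 𝒦

  down : (A : ℕ → Obj) (π : ∀ n → Car (A (suc n)) → Car (A n)) →
         ∀ m k → Car (A (k + m)) → Car (A m)
  down A π m zero    x = x
  down A π m (suc k) x = down A π m k (π (k + m) x)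

  record FraisseSeq : Set where
    field
      A    : ℕ → Obj
      π    : ∀ n → Car (A (suc n)) → Car (A n)
      π-epi : ∀ n → Epi (A (suc n)) (A n) (π n)
      onto    : ∀ B → ∃[ m ] ∃[ f ] Epi (A m) B f
      extend  : ∀ B m (f : Car B → Car (A m)) → Epi B (A m) f →
                ∃[ k ] ∃[ g ] (Epi (A (suc k + m)) B g ×
                  (∀ x → f (g x) ≡ down A π m (suc k) x))

  module _ (S : FraisseSeq) where
    open FraisseSeq S

    -- points of the limit 𝕂 = lim← (A_n, π_n): compatible threads
    record Pt : Set where
      constructor pt
      field
        coord  : (n : ℕ) → Car (A n)
        compat : ∀ n → π n (coord (suc n)) ≡ coord n
    open Pt public

    EpiLim : (B : Obj) → (Pt → Car B) → Set
    EpiLim B φ = ∃[ n ] ∃[ f ] (Epi (A n) B f × (∀ x → φ x ≡ f (coord x n)))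

    RLim : Pt → Pt → Set
    RLim x y = ∀ B (φ : Pt → Car B) → EpiLim B φ → Adj (graph B) (φ x) (φ y)

    Transitive : Set
    Transitive = ∀ x y z → RLim x y → RLim y z → RLim x z

{-# OPTIONS --safe #-}

-- Fix a level p.  If no bond A_j → A_p maps R²-paths of A_j into R, then every level j ≥ p
-- carries a path a R c R b whose ends are non-adjacent in A_p.  The A_j are finite, so by
-- König's lemma these obstructions can be chosen coherently along the tower, giving points
-- x R z R y of 𝕂 with x, y non-adjacent in A_p, against transitivity of R^𝕂.  Composing
-- such bonds k − 1 times yields a map A_m → A_n sending R^k into R; take B = A_m, ψ = π^∞_m.

module Submission where

open import Defs hiding (refl; sym)
open import Data.Nat using (ℕ; zero; suc; _+_; _≤_; _≤′_; ≤′-reflexive; ≤′-refl; ≤′-step; z≤n; s≤s)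
open import Data.Nat.Properties
  using (≡-irrelevant; <-irrefl; ≤′⇒≤; ≤-trans; +-suc; +-monoˡ-≤; m≤m+n; m≤n+m; n≤′m+n)
open import Data.Fin using (Fin)
open import Data.Fin.Properties using (¬Fin0)
open import Data.Product using (Σ; ∃; ∃-syntax; _×_; _,_; proj₁; proj₂; map; map₂)
open import Data.Empty using (⊥-elim)
open import Function using (_∘_; id)
open import Level using (0ℓ)
open import Relation.Nullary using (¬_; yes; no)
open import Relation.Nullary.Negation using (¬∃⟶∀¬)
open import Relation.Unary using (Pred; _⊆_; Satisfiable; ⋂)
open import Relation.Binary.PropositionalEquality
  using (_≡_; refl; sym; trans; cong; subst; subst₂)
open import Axiom.ExcludedMiddle using (ExcludedMiddle)
open import Axiom.DoubleNegationElimination using (DoubleNegationElimination; em⇒dne)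

Compact : Set → Set₁
Compact X = (Q : ℕ → Pred X 0ℓ) → (∀ {d e} → d ≤ e → Q e ⊆ Q d) →
            (∀ d → Satisfiable (Q d)) → Satisfiable (⋂ ℕ Q)

Fin-compact : ExcludedMiddle 0ℓ → ∀ n → Compact (Fin n)
Fin-compact em zero    Q _ sat = ⊥-elim (¬Fin0 (proj₁ (sat 0)))
Fin-compact em (suc n) Q anti sat with em {⋂ ℕ Q Fin.zero}
... | yes zero∈⋂ = Fin.zero , zero∈⋂
... | no  zero∉⋂ with em⇒dne em (λ ¬∃ → zero∉⋂ λ d → em⇒dne em (¬∃⟶∀¬ ¬∃ d))
... | d₀ , zero∉Q₀ =
  let (x , x∈⋂) = Fin-compact em n (λ d x → Q (d + d₀) (Fin.suc x))
                    (λ le → anti (+-monoˡ-≤ d₀ le)) shifted-sat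
  in Fin.suc x , λ d → anti (m≤m+n d d₀) (x∈⋂ d)
  where
  shifted-sat : ∀ d → Satisfiable (λ x → Q (d + d₀) (Fin.suc x))
  shifted-sat d with sat (d + d₀)
  ... | Fin.zero  , q = ⊥-elim (zero∉Q₀ (anti (m≤n+m d₀ d) q))
  ... | Fin.suc x , q = x , q

×-compact : ∀ {X Y} → Compact X → Compact Y → Compact (X × Y)
×-compact compactX compactY Q anti sat =
  let (x , x∈⋂) = compactX (λ d x → ∃ λ y → Q d (x , y))
                    (λ le → map₂ (anti le)) (λ d → let ((x , y) , q) = sat d in x , y , q)
      (y , y∈⋂) = compactY (λ d y → Q d (x , y)) (λ le → anti le) x∈⋂
  in (x , y) , y∈⋂

module _ {X : ℕ → Set} (proj : ∀ i → X (suc i) → X i) (compact : ∀ i → Compact (X i))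
         (G : ∀ i → Pred (X i) 0ℓ) (G-proj : ∀ {i x} → G (suc i) x → G i (proj i x)) where

  Lifts : ∀ i → ℕ → Pred (X i) 0ℓ
  Lifts i zero    x = G i x
  Lifts i (suc d) x = ∃ λ y → proj i y ≡ x × Lifts (suc i) d y

  lifts⇒G : ∀ {i} d {x} → Lifts i d x → G i x
  lifts⇒G zero    g              = g
  lifts⇒G (suc d) (y , refl , l) = G-proj (lifts⇒G d l)

  lifts-antitone : ∀ {i d e} → d ≤ e → Lifts i e ⊆ Lifts i d
  lifts-antitone {e = e} z≤n      l            = lifts⇒G e l
  lifts-antitone         (s≤s le) (y , eq , l) = y , eq , lifts-antitone le l

  lifts-to-root : ∀ j d {y} → Lifts j d y → Satisfiable (Lifts 0 (j + d))
  lifts-to-root zero    d     l = _ , l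
  lifts-to-root (suc j) d {y} l =
    subst (Satisfiable ∘ Lifts 0) (+-suc j d) (lifts-to-root j (suc d) (y , refl , l))

  module _ (G-unbounded : ∀ d → ∃[ j ] (d ≤ j × Satisfiable (G j))) where
    root : Satisfiable (⋂ ℕ (Lifts 0))
    root = compact 0 (Lifts 0) lifts-antitone λ d →
      let (j , d≤j , y , g) = G-unbounded d
          (x , l) = lifts-to-root j 0 g
      in x , lifts-antitone (≤-trans d≤j (m≤m+n j 0)) l

    child : ∀ {i x} → ⋂ ℕ (Lifts i) x → ∃ λ y → proj i y ≡ x × ⋂ ℕ (Lifts (suc i)) y
    child {i} {x} l =
      let (y , y∈⋂) = compact (suc i) (λ d y → proj i y ≡ x × Lifts (suc i) d y)
                        (λ le → map₂ (lifts-antitone le)) (l ∘ suc)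
      in y , proj₁ (y∈⋂ 0) , proj₂ ∘ y∈⋂

    branch : ∀ i → Σ (X i) (⋂ ℕ (Lifts i))
    branch zero    = root
    branch (suc i) = map₂ proj₂ (child (proj₂ (branch i)))

    königs-lemma : ∃[ t ] ((∀ i → proj i (t (suc i)) ≡ t i) × (∀ i → G i (t i)))
    königs-lemma = proj₁ ∘ branch , (λ i → proj₁ (proj₂ (child (proj₂ (branch i))))) ,
                   λ i → proj₂ (branch i) 0

≤′-irrelevant : ∀ {m n} (h h′ : m ≤′ n) → h ≡ h′
≤′-irrelevant (≤′-reflexive e) (≤′-reflexive e′) = cong ≤′-reflexive (≡-irrelevant e e′)
≤′-irrelevant ≤′-refl          (≤′-step h′)      = ⊥-elim (<-irrefl refl (≤′⇒≤ h′))
≤′-irrelevant (≤′-step h)      ≤′-refl           = ⊥-elim (<-irrefl refl (≤′⇒≤ h))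
≤′-irrelevant (≤′-step h)      (≤′-step h′)      = cong ≤′-step (≤′-irrelevant h h′)

Contracting : (G H : FGraph) → ℕ → (V G → V H) → Set
Contracting G H k f = ∀ a b → AdjPow G k a b → Adj H (f a) (f b)

AdjPow-map : ∀ {G H} {f : V G → V H} → (∀ x y → Adj G x y → Adj H (f x) (f y)) →
             ∀ k {a b} → AdjPow G k a b → AdjPow H k (f a) (f b)
AdjPow-map f-adj zero    refl         = refl
AdjPow-map f-adj (suc k) (c , ac , r) = _ , f-adj _ c ac , AdjPow-map f-adj k r

contracting-∘ : ∀ {F G H k} {f : V G → V H} {g : V F → V G} →
                (∀ x y → Adj F x y → Adj G (g x) (g y)) → Contracting F G 2 g →
                Contracting G H (suc k) f → Contracting F H (suc (suc k)) (f ∘ g)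
contracting-∘ {k = k} g-adj g-contracting f-contracting a b (c , ac , d , cd , r) =
  f-contracting _ _ (_ , g-contracting a d (c , ac , d , cd , refl) , AdjPow-map g-adj k r)

module Limit (em : ExcludedMiddle 0ℓ) (𝒦 : ProjClass) (S : FraisseSeq 𝒦) where
  open ProjClass 𝒦
  open FraisseSeq S
  open Pt

  dne : DoubleNegationElimination 0ℓ
  dne = em⇒dne em

  Adjₙ : ∀ n → Car (A n) → Car (A n) → Set
  Adjₙ n = Adj (graph (A n))

  epi-adj : ∀ {B C f} → Epi B C f → ∀ x y → Adj (graph B) x y → Adj (graph C) (f x) (f y)
  epi-adj = proj₁ ∘ epi-strong

  bond : ∀ {m n} → m ≤′ n → Car (A n) → Car (A m)
  bond ≤′-refl     x = x
  bond (≤′-step h) x = bond h (π _ x)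

  bond-epi : ∀ {m n} (h : m ≤′ n) → Epi (A n) (A m) (bond h)
  bond-epi ≤′-refl     = epi-id _
  bond-epi (≤′-step h) = epi-comp (π-epi _) (bond-epi h)

  bond-coord : ∀ {m n} (h : m ≤′ n) (x : Pt 𝒦 S) → bond h (coord x n) ≡ coord x m
  bond-coord ≤′-refl         x = refl
  bond-coord (≤′-step {n} h) x = trans (cong (bond h) (compat x n)) (bond-coord h x)

  RLim-intro : ∀ {x y} → (∀ n → Adjₙ n (coord x n) (coord y n)) → RLim 𝒦 S x y
  RLim-intro {x} {y} adj B ψ (n , f , f-epi , ψ≗) =
    subst₂ (Adj (graph B)) (sym (ψ≗ x)) (sym (ψ≗ y)) (epi-adj f-epi _ _ (adj n))

  RLim-coord : ∀ {x y} → RLim 𝒦 S x y → ∀ n → Adjₙ n (coord x n) (coord y n)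
  RLim-coord r n = r (A n) (λ x → coord x n) (n , id , epi-id (A n) , λ _ → refl)

  Triple : ℕ → Set
  Triple j = Car (A j) × Car (A j) × Car (A j)

  π³ : ∀ j → Triple (suc j) → Triple j
  π³ j = map (π j) (map (π j) (π j))

  Triple-compact : ∀ j → Compact (Triple j)
  Triple-compact j = ×-compact (Fin-compact em _) (×-compact (Fin-compact em _) (Fin-compact em _))

  -- Quantifying over p ≤′ j makes the last conjunct vacuous below level p, so obstructions
  -- are closed under π³ at every level.
  Obstruction : ℕ → ∀ j → Pred (Triple j) 0ℓ
  Obstruction p j (a , c , b) =
    Adjₙ j a c × Adjₙ j c b × ((h : p ≤′ j) → ¬ Adjₙ p (bond h a) (bond h b))

  obstruction-π³ : ∀ {p j t} → Obstruction p (suc j) t → Obstruction p j (π³ j t)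
  obstruction-π³ {j = j} (ac , cb , far) =
    epi-adj (π-epi j) _ _ ac , epi-adj (π-epi j) _ _ cb , far ∘ ≤′-step

  EventuallyContracting : ℕ → Set
  EventuallyContracting p =
    ∃[ j ] Σ (p ≤′ j) λ h → Contracting (graph (A j)) (graph (A p)) 2 (bond h)

  no-obstruction-thread : Transitive 𝒦 S → ∀ p (t : ∀ j → Triple j) →
                          (∀ j → π³ j (t (suc j)) ≡ t j) → ¬ (∀ j → Obstruction p j (t j))
  no-obstruction-thread tr p t t-compat obstructs =
    proj₂ (proj₂ (obstructs p)) ≤′-refl (RLim-coord (tr x z y x-z z-y) p)
    where
    x z y : Pt 𝒦 S
    x = pt (proj₁ ∘ t) (cong proj₁ ∘ t-compat)
    z = pt (proj₁ ∘ proj₂ ∘ t) (cong (proj₁ ∘ proj₂) ∘ t-compat)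
    y = pt (proj₂ ∘ proj₂ ∘ t) (cong (proj₂ ∘ proj₂) ∘ t-compat)

    x-z : RLim 𝒦 S x z
    x-z = RLim-intro (proj₁ ∘ obstructs)

    z-y : RLim 𝒦 S z y
    z-y = RLim-intro (proj₁ ∘ proj₂ ∘ obstructs)

  obstruction-at : ∀ {p j} → ¬ EventuallyContracting p → (h : p ≤′ j) → Satisfiable (Obstruction p j)
  obstruction-at {p} {j} never h = dne λ none → never (j , h , λ where
    a b (c , ac , _ , cb , refl) → dne λ far →
      none ((a , c , b) , ac , cb ,
            λ h′ → subst (λ h → ¬ Adjₙ p (bond h a) (bond h b)) (≤′-irrelevant h h′) far))

  eventually-contracting : Transitive 𝒦 S → ∀ p → EventuallyContracting p
  eventually-contracting tr p = dne λ never →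
    let (t , t-compat , obstructs) =
          königs-lemma π³ Triple-compact (Obstruction p) obstruction-π³
            (λ d → d + p , m≤m+n d p , obstruction-at never (n≤′m+n d p))
    in no-obstruction-thread tr p t t-compat obstructs

  contracting-refinement :
    (∀ p → EventuallyContracting p) →
    ∀ n k → ∃[ m ] ∃[ h ] (Epi (A m) (A n) h × (∀ (x : Pt 𝒦 S) → h (coord x m) ≡ coord x n) ×
                           Contracting (graph (A m)) (graph (A n)) (suc k) h)
  contracting-refinement _ n zero = n , id , epi-id (A n) , (λ _ → refl) , λ where
    a b (c , ac , refl) → ac
  contracting-refinement eventually n (suc k) =
    let (m , h , h-epi , h-coord , h-contracting) = contracting-refinement eventually n k
        (j , m≤j , bond-contracting) = eventually m
    in j , h ∘ bond m≤j , epi-comp (bond-epi m≤j) h-epi ,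
       (λ x → trans (cong h (bond-coord m≤j x)) (h-coord x)) ,
       contracting-∘ {H = graph (A n)} (epi-adj (bond-epi m≤j)) bond-contracting h-contracting

lemma2p1 : ExcludedMiddle 0ℓ →
    (𝒦 : ProjClass) (S : FraisseSeq 𝒦) →
    Transitive 𝒦 S →
    (k : ℕ) → 1 ≤ k →
    (A : ProjClass.Obj 𝒦) (φ : Pt 𝒦 S → ProjClass.Car 𝒦 A) →
    EpiLim 𝒦 S A φ →
    ∃[ B ] ∃[ ψ ] ∃[ f ]
      (EpiLim 𝒦 S B ψ × ProjClass.Epi 𝒦 B A f ×
       (∀ x → φ x ≡ f (ψ x)) ×
       (∀ a b → AdjPow (ProjClass.graph 𝒦 B) k a b →
          Adj (ProjClass.graph 𝒦 A) (f a) (f b)))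
lemma2p1 em 𝒦 S tr (suc k) (s≤s _) A φ (n , f , f-epi , φ≗) =
  let (m , h , h-epi , h-coord , h-contracting) =
        contracting-refinement (eventually-contracting tr) n k
  in FraisseSeq.A S m , (λ x → coord x m) , f ∘ h ,
     (m , id , epi-id _ , λ _ → refl) , epi-comp h-epi f-epi ,
     (λ x → trans (φ≗ x) (cong f (sym (h-coord x)))) ,
     λ a b ab → epi-adj f-epi _ _ (h-contracting a b ab)
  where
  open ProjClass 𝒦 using (epi-id; epi-comp)
  open Limit em 𝒦 S
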